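{- Let $G$ be a finite abelian group of order $n$ such that the generalized dihedral group $D(G)$ is non-abelian, and let $r\ge0$ satisfy $2^r=|\{g\in G:g^2=e\}|$. Then the commuting graph $\Gamma=\mathfrak{C}(D(G),D(G))$ satisfies \[\Gamma\cong K_{2^r}\vee\Big(K_{n-2^r}\cup \tfrac{n}{2^r}K_{2^r}\Big).\]
   Context: $D(G)=G\rtimes C_2$, $C_2=\{1,-1\}$, has elements $(g,c)$ and multiplication $(g_1,c_1)(g_2,c_2)=(g_1g_2^{c_1},c_1c_2)$. The commuting graph $\mathfrak{C}(D(G),X)$ of $X\subseteq D(G)$ has vertex set $X$, distinct $u,v$ adjacent iff $uv=vu$. $K_m$ is the complete graph on $m$ vertices; $\Gamma'\vee\Gamma''$ is the join (disjoint union plus all edges between the two vertex sets); $\Gamma'\cup\Gamma''$ is the disjoint union; $mK_s$ is the disjoint union of $m$ copies of $K_s$. -}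

module Defs where

open import Level using (0ℓ)
open import Data.Nat using (ℕ; zero; suc; _^_; _/_)
open import Data.Nat.Properties using (m^n≢0)
open import Data.Fin using (Fin)
open import Data.Fin.Properties using (_≟_)
open import Data.List using (length; filter)
open import Data.List.Base using (allFin)
open import Data.Product using (_×_; _,_; Σ)
open import Data.Sum using (_⊎_; inj₁; inj₂)
open import Data.Empty using (⊥)
open import Data.Unit using (⊤)
open import Relation.Nullary using (¬_)
open import Relation.Binary.PropositionalEquality using (_≡_; _≢_)
open import Algebra.Structures using (IsAbelianGroup)
open import Function.Bundles using (_⤖_; _⇔_; Bijection)

-- A finite abelian group of order n, realised on the carrier Fin n
-- (every finite abelian group of order n is isomorphic to one of these).
record FinAbGroup (n : ℕ) : Set where
  field
    _∙_ : Fin n → Fin n → Fin n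
    e   : Fin n
    _⁻¹ : Fin n → Fin n
    isAbelianGroup : IsAbelianGroup _≡_ _∙_ e _⁻¹
  infixl 7 _∙_
  infix 8 _⁻¹

data C₂ : Set where
  one minusOne : C₂

_·c_ : C₂ → C₂ → C₂
one      ·c c = c
minusOne ·c one = minusOne
minusOne ·c minusOne = one

module _ {n : ℕ} (G : FinAbGroup n) where
  open FinAbGroup G

  pow : Fin n → C₂ → Fin n
  pow g one      = g
  pow g minusOne = g ⁻¹

  D : Set
  D = Fin n × C₂

  _⊗_ : D → D → D
  (g₁ , c₁) ⊗ (g₂ , c₂) = (g₁ ∙ pow g₂ c₁ , c₁ ·c c₂)

  DAbelian : Set
  DAbelian = ∀ x y → x ⊗ y ≡ y ⊗ x

  numSqrtId : ℕ
  numSqrtId = length (filter (λ g → (g ∙ g) ≟ e) (allFin n))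

record Graph : Set₁ where
  field
    V   : Set
    Adj : V → V → Set
open Graph public

commutingGraph : ∀ {n} → FinAbGroup n → Graph
commutingGraph G = record
  { V = D G
  ; Adj = λ u v → (u ≢ v) × (_⊗_ G u v ≡ _⊗_ G v u) }

K : ℕ → Graph
K m = record { V = Fin m ; Adj = λ u v → u ≢ v }

_∪ᴳ_ : Graph → Graph → Graph
Γ ∪ᴳ Δ = record { V = V Γ ⊎ V Δ ; Adj = adj }
  where
  adj : V Γ ⊎ V Δ → V Γ ⊎ V Δ → Set
  adj (inj₁ a) (inj₁ b) = Adj Γ a b
  adj (inj₂ a) (inj₂ b) = Adj Δ a b
  adj _ _ = ⊥

_∨ᴳ_ : Graph → Graph → Graph
Γ ∨ᴳ Δ = record { V = V Γ ⊎ V Δ ; Adj = adj }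
  where
  adj : V Γ ⊎ V Δ → V Γ ⊎ V Δ → Set
  adj (inj₁ a) (inj₁ b) = Adj Γ a b
  adj (inj₂ a) (inj₂ b) = Adj Δ a b
  adj (inj₁ _) (inj₂ _) = ⊤
  adj (inj₂ _) (inj₁ _) = ⊤

emptyGraph : Graph
emptyGraph = record { V = ⊥ ; Adj = λ _ _ → ⊥ }

copies : ℕ → Graph → Graph
copies zero    Γ = emptyGraph
copies (suc m) Γ = Γ ∪ᴳ copies m Γ

_≅ᴳ_ : Graph → Graph → Set
Γ ≅ᴳ Δ = Σ (V Γ ⤖ V Δ) λ f →
  ∀ u v → Adj Γ u v ⇔ Adj Δ (Bijection.to f u) (Bijection.to f v)

_/2^_ : ℕ → ℕ → ℕ
n /2^ r = _/_ n (2 ^ r) {{m^n≢0 2 r}}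

module Submission where

-- Write T = {g ∈ G : g² = e} (a subgroup of order k = 2^r).  In D(G):
--   * two rotations (g,1), (h,1) always commute;
--   * a rotation (g,1) commutes with a reflection (h,-1) iff g ∈ T;
--   * two reflections (g,-1), (h,-1) commute iff g h⁻¹ ∈ T, i.e. iff g and h
--     lie in the same coset of T.
-- So the rotations in T are joined to everything, the other n - k rotations form
-- a clique, and the reflections form one clique per coset of T (n / k cliques of
-- size k): the graph is K_k ∨ (K_{n-k} ∪ (n/k) K_k).
--
-- Then the
-- group computations in D(G) are done, and the theorem assembles these pieces.

open import Defs
open import Level using (0ℓ)
open import Data.Nat using (ℕ; zero; suc; _*_; _∸_; _^_)
open import Data.Nat.Properties using (m+n∸m≡n; m^n≢0)
open import Data.Nat.DivMod using (m*n/n≡m)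
open import Data.Fin using (Fin; zero; suc)
open import Data.Fin.Properties using (+↔⊎; 1↔⊤; *↔×; suc-injective; _≟_)
open import Data.Fin.Permutation using (↔⇒≡)
open import Data.List using (length; filter; tabulate; allFin)
open import Data.Product using (Σ; ∃; _×_; _,_; proj₁; proj₂)
open import Data.Product.Function.NonDependent.Propositional using (_×-⇔_; _×-↔_)
open import Data.Product.Function.Dependent.Propositional using (Σ-↔)
open import Data.Sum using (_⊎_; inj₁; inj₂; [_,_]; assocʳ)
open import Data.Sum.Properties using (inj₁-injective; inj₂-injective)
open import Data.Sum.Algebra using (⊎-assoc)
open import Data.Sum.Function.Propositional using (_⊎-↔_)
open import Data.Empty using (⊥; ⊥-elim)
open import Data.Unit using (⊤; tt)
open import Data.Bool.Properties using (T-irrelevant)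
open import Data.Bool using (T?; not)
open import Function using (_∘_; id)
open import Function.Bundles using (_↔_; _⇔_; mk↔ₛ′; mk⇔; Inverse; Equivalence; Injection)
open import Function.Construct.Composition using (_↔-∘_; _⇔-∘_)
open import Function.Construct.Symmetry using (↔-sym; ⇔-sym)
open import Function.Properties.Inverse using (↔-refl; ↔⇒⤖; ↔⇒↣)
open import Function.Properties.Equivalence using () renaming (refl to ⇔-refl)
open import Function.Related.Propositional using (module EquationalReasoning; bijection)
open import Relation.Nullary using (¬_; Dec; yes; no; Irrelevant; contradiction)
open import Relation.Nullary.Decidable using (False; isYes)
open import Relation.Unary using (Decidable)
open import Relation.Binary using (Rel; IsEquivalence)
open import Relation.Binary.PropositionalEquality using (_≡_; _≢_; refl; sym; trans; cong; cong₂; subst)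
open import Axiom.UniquenessOfIdentityProofs using (module Decidable⇒UIP)
open import Algebra.Bundles using (AbelianGroup)
import Algebra.Properties.AbelianGroup as AbelianGroupProperties
import Algebra.Properties.CommutativeSemigroup as CommutativeSemigroupProperties

open Inverse using (to)
open Equivalence using () renaming (to to ⇒; from to ⇐)

IsInj₁ : {A B : Set} → A ⊎ B → Set
IsInj₁ (inj₁ _) = ⊤
IsInj₁ (inj₂ _) = ⊥

⊎-↔-IsInj₁ : ∀ {A B C D : Set} (f : A ↔ C) (g : B ↔ D) x → IsInj₁ (to (f ⊎-↔ g) x) ⇔ IsInj₁ x
⊎-↔-IsInj₁ f g (inj₁ _) = mk⇔ _ _
⊎-↔-IsInj₁ f g (inj₂ _) = mk⇔ (λ ()) (λ ())

↔-injective : {A B : Set} (f : A ↔ B) → ∀ {x y} → to f x ≡ to f y → x ≡ y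
↔-injective f = Injection.injective (↔⇒↣ f)

Fin-cong : ∀ {m m′} → m ≡ m′ → Fin m ↔ Fin m′
Fin-cong refl = ↔-refl

Fin-UIP : ∀ {n} {i j : Fin n} → Irrelevant (i ≡ j)
Fin-UIP = Decidable⇒UIP.≡-irrelevant _≟_

Σ-≡ : {A : Set} {B : A → Set} → (∀ {a} → Irrelevant (B a)) → {p q : Σ A B} → proj₁ p ≡ proj₁ q → p ≡ q
Σ-≡ irr {a , b} {.a , c} refl = cong (a ,_) (irr b c)

Σ-Fin-suc : ∀ {n} {Q : Fin (suc n) → Set} → Σ (Fin (suc n)) Q ↔ (Q zero ⊎ Σ (Fin n) (Q ∘ suc))
Σ-Fin-suc {n} {Q} = mk↔ₛ′ peel unpeel (λ { (inj₁ _) → refl ; (inj₂ _) → refl })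
                                      (λ { (zero , _) → refl ; (suc _ , _) → refl })
  where
  peel : Σ (Fin (suc n)) Q → Q zero ⊎ Σ (Fin n) (Q ∘ suc)
  peel (zero , q)  = inj₁ q
  peel (suc i , q) = inj₂ (i , q)
  unpeel : Q zero ⊎ Σ (Fin n) (Q ∘ suc) → Σ (Fin (suc n)) Q
  unpeel (inj₁ q)       = zero , q
  unpeel (inj₂ (i , q)) = suc i , q

module _ {A : Set} {P : A → Set} (P? : Decidable P) (P-irrelevant : ∀ {x} → Irrelevant (P x)) where
  open EquationalReasoning {k = bijection}

  -- Sorting x according to a decision d for P x; d is tied to P? x by an
  -- equation so that a refutation can be recorded as an element of False (P? x).
  private
    sortWith : ∀ x (d : Dec (P x)) → d ≡ P? x → Σ A P ⊎ Σ A (False ∘ P?)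
    sortWith x (yes p) _ = inj₁ (x , p)
    sortWith x (no _)  e = inj₂ (x , subst False e tt)

    sortWith-inj₁ : ∀ x d e (p : P x) → sortWith x d e ≡ inj₁ (x , p)
    sortWith-inj₁ x (yes p′) _ p = cong (λ p → inj₁ (x , p)) (P-irrelevant p′ p)
    sortWith-inj₁ x (no ¬p)  _ p = contradiction p ¬p

    sortWith-inj₂ : ∀ x d e (f : False (P? x)) → sortWith x d e ≡ inj₂ (x , f)
    sortWith-inj₂ x (yes _) e f = ⊥-elim (subst False (sym e) f)
    sortWith-inj₂ x (no _)  e f = cong (λ f → inj₂ (x , f)) (T-irrelevant _ f)

    sortWith-forget : ∀ x d e → [ proj₁ , proj₁ ] (sortWith x d e) ≡ x
    sortWith-forget x (yes _) _ = refl
    sortWith-forget x (no _)  _ = refl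

    sortWith-IsInj₁ : ∀ x d e → IsInj₁ (sortWith x d e) ⇔ P x
    sortWith-IsInj₁ x (yes p) _ = mk⇔ (λ _ → p) (λ _ → tt)
    sortWith-IsInj₁ x (no ¬p) _ = mk⇔ ⊥-elim ¬p

  split : A ↔ (Σ A P ⊎ Σ A (False ∘ P?))
  split = mk↔ₛ′ sort [ proj₁ , proj₁ ] sort∘forget (λ x → sortWith-forget x (P? x) refl)
    where
    sort : A → Σ A P ⊎ Σ A (False ∘ P?)
    sort x = sortWith x (P? x) refl
    sort∘forget : ∀ y → sort ([ proj₁ , proj₁ ] y) ≡ y
    sort∘forget (inj₁ (x , p)) = sortWith-inj₁ x (P? x) refl p
    sort∘forget (inj₂ (x , f)) = sortWith-inj₂ x (P? x) refl f

  split-IsInj₁ : ∀ x → IsInj₁ (to split x) ⇔ P x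
  split-IsInj₁ x = sortWith-IsInj₁ x (P? x) refl

  Σ-count : ∀ {n} (f : Fin n → A) → Σ (Fin n) (P ∘ f) ↔ Fin (length (filter P? (tabulate f)))
  Σ-count {zero}  f = mk↔ₛ′ (λ ()) (λ ()) (λ ()) (λ ())
  Σ-count {suc n} f with P? (f zero)
  ... | yes p = begin
    Σ (Fin (suc n)) (P ∘ f)                   ↔⟨ Σ-Fin-suc ⟩
    (P (f zero) ⊎ Σ (Fin n) (P ∘ f ∘ suc))    ↔⟨ holds ⊎-↔ Σ-count (f ∘ suc) ⟩
    (⊤ ⊎ Fin _)                               ↔⟨ 1↔⊤ ⊎-↔ ↔-refl ⟨
    (Fin 1 ⊎ Fin _)                           ↔⟨ +↔⊎ ⟨
    Fin _                                     ∎
    where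
    holds : P (f zero) ↔ ⊤
    holds = mk↔ₛ′ _ (λ _ → p) (λ _ → refl) (P-irrelevant p)
  ... | no ¬p = Σ-count (f ∘ suc) ↔-∘ skipFirst
    where
    skipFirst : Σ (Fin (suc n)) (P ∘ f) ↔ Σ (Fin n) (P ∘ f ∘ suc)
    skipFirst = mk↔ₛ′ (λ { (zero , p) → contradiction p ¬p ; (suc i , p) → i , p })
                      (λ (i , p) → suc i , p) (λ _ → refl)
                      (λ { (zero , p) → contradiction p ¬p ; (suc i , p) → refl })

module _ {n : ℕ} {P : Fin n → Set} (P? : Decidable P) (P-irrelevant : ∀ {x} → Irrelevant (P x)) where

  count : ℕ
  count = length (filter P? (allFin n))

  private
    refuted : ℕ
    refuted = length (filter (λ i → T? (not (isYes (P? i)))) (allFin n))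

    satisfying : Σ (Fin n) P ↔ Fin count
    satisfying = Σ-count P? P-irrelevant id

    refuting : Σ (Fin n) (False ∘ P?) ↔ Fin refuted
    refuting = Σ-count (λ i → T? (not (isYes (P? i)))) T-irrelevant id

    sides : Fin n ↔ (Fin count ⊎ Fin refuted)
    sides = (satisfying ⊎-↔ refuting) ↔-∘ split P? P-irrelevant

    -- The two sides together have n elements.
    refuted≡ : refuted ≡ n ∸ count
    refuted≡ = trans (sym (m+n∸m≡n count refuted)) (cong (_∸ count) (sym (↔⇒≡ (↔-sym +↔⊎ ↔-∘ sides))))

  partition : Fin n ↔ (Fin count ⊎ Fin (n ∸ count))
  partition = (↔-refl ⊎-↔ Fin-cong refuted≡) ↔-∘ sides

  partition-IsInj₁ : ∀ i → IsInj₁ (to partition i) ⇔ P i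
  partition-IsInj₁ i = split-IsInj₁ P? P-irrelevant i
                   ⇔-∘ (⊎-↔-IsInj₁ satisfying refuting (to (split P? P-irrelevant) i)
                   ⇔-∘ ⊎-↔-IsInj₁ ↔-refl (Fin-cong refuted≡) (to sides i))

∃-suc : ∀ {m} {Q : Fin (suc m) → Set} → ¬ Q zero → ∃ Q → ∃ (Q ∘ suc)
∃-suc ¬q (zero , q)  = contradiction q ¬q
∃-suc ¬q (suc i , q) = i , q

least : ∀ {m} {Q : Fin m → Set} → Decidable Q → ∃ Q → Fin m
least {suc m} Q? w with Q? zero
... | yes _ = zero
... | no ¬q = suc (least (Q? ∘ suc) (∃-suc ¬q w))

least-satisfies : ∀ {m} {Q : Fin m → Set} (Q? : Decidable Q) (w : ∃ Q) → Q (least Q? w)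
least-satisfies {suc m} Q? w with Q? zero
... | yes q = q
... | no ¬q = least-satisfies (Q? ∘ suc) (∃-suc ¬q w)

least-cong : ∀ {m} {Q Q′ : Fin m → Set} (Q? : Decidable Q) (Q′? : Decidable Q′) (w : ∃ Q) (w′ : ∃ Q′) →
             (∀ i → Q i ⇔ Q′ i) → least Q? w ≡ least Q′? w′
least-cong {suc m} Q? Q′? w w′ Q⇔Q′ with Q? zero | Q′? zero
... | yes _ | yes _   = refl
... | yes q | no ¬q′  = contradiction (⇒ (Q⇔Q′ zero) q) ¬q′
... | no ¬q | yes q′  = contradiction (⇐ (Q⇔Q′ zero) q′) ¬q
... | no ¬q | no ¬q′  = cong suc (least-cong (Q? ∘ suc) (Q′? ∘ suc) (∃-suc ¬q w) (∃-suc ¬q′ w′) (Q⇔Q′ ∘ suc))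

-- Canonical representatives for a decidable, proof-irrelevant equivalence relation on Fin n
-- (a substitute for the quotient, which is not available as a type).
module Representatives {n : ℕ} {_~_ : Rel (Fin n) 0ℓ} (_~?_ : ∀ x y → Dec (x ~ y))
                       (~-isEquivalence : IsEquivalence _~_) (~-irrelevant : ∀ {x y} → Irrelevant (x ~ y)) where
  open IsEquivalence ~-isEquivalence renaming (refl to ~-refl; sym to ~-sym; trans to ~-trans)

  rep : Fin n → Fin n
  rep x = least (_~? x) (x , ~-refl)

  rep-~ : ∀ x → rep x ~ x
  rep-~ x = least-satisfies (_~? x) (x , ~-refl)

  rep-≡⇔~ : ∀ x y → rep x ≡ rep y ⇔ x ~ y
  rep-≡⇔~ x y = mk⇔ (λ eq → ~-trans (~-sym (rep-~ x)) (subst (_~ y) (sym eq) (rep-~ y)))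
                    (λ x~y → least-cong _ _ _ _ λ z → mk⇔ (λ z~x → ~-trans z~x x~y) (λ z~y → ~-trans z~y (~-sym x~y)))

  rep-idempotent : ∀ x → rep (rep x) ≡ rep x
  rep-idempotent x = ⇐ (rep-≡⇔~ (rep x) x) (rep-~ x)

  Rep : Set
  Rep = Σ (Fin n) (λ r → rep r ≡ r)

  #classes : ℕ
  #classes = length (filter (λ r → rep r ≟ r) (allFin n))

  representatives : Rep ↔ Fin #classes
  representatives = Σ-count (λ r → rep r ≟ r) Fin-UIP id

  Class : Rep → Set
  Class (r , _) = Σ (Fin n) (λ y → rep y ≡ r)

  byClass : Fin n ↔ Σ Rep Class
  byClass = mk↔ₛ′ (λ x → (rep x , rep-idempotent x) , x , refl) (proj₁ ∘ proj₂) classify∘forget (λ _ → refl)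
    where
    classify∘forget : ∀ c → ((rep (proj₁ (proj₂ c)) , rep-idempotent _) , proj₁ (proj₂ c) , refl) ≡ c
    classify∘forget ((r , r-rep) , (y , refl)) = cong (λ p → (rep y , p) , y , refl) (Fin-UIP _ r-rep)

  Class↔ : ∀ r (r-rep : rep r ≡ r) → Class (r , r-rep) ↔ Σ (Fin n) (_~ r)
  Class↔ r r-rep = mk↔ₛ′ (λ (y , e) → y , ⇒ (rep-≡⇔~ y r) (trans e (sym r-rep)))
                         (λ (y , y~r) → y , trans (⇐ (rep-≡⇔~ y r) y~r) r-rep)
                         (λ _ → Σ-≡ ~-irrelevant refl) (λ _ → Σ-≡ Fin-UIP refl)

  module _ {k : ℕ} (classSize : ∀ r → Σ (Fin n) (_~ r) ↔ Fin k) where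

    classes : Fin n ↔ (Fin #classes × Fin k)
    classes = (representatives ×-↔ ↔-refl)
              ↔-∘ (Σ-↔ {B = λ _ → Fin k} ↔-refl (λ {(r , r-rep)} → classSize r ↔-∘ Class↔ r r-rep) ↔-∘ byClass)

    classes-proj₁ : ∀ x y → proj₁ (to classes x) ≡ proj₁ (to classes y) ⇔ x ~ y
    classes-proj₁ x y = mk⇔ (λ eq → ⇒ (rep-≡⇔~ x y) (cong proj₁ (↔-injective representatives eq)))
                            (λ x~y → cong (to representatives) (Σ-≡ Fin-UIP (⇐ (rep-≡⇔~ x y) x~y)))

    #classes*k≡n : #classes * k ≡ n
    #classes*k≡n = sym (↔⇒≡ (↔-sym *↔× ↔-∘ classes))

_DescribedBy_ : (Γ : Graph) → Rel (V Γ) 0ℓ → Set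
Γ DescribedBy R = ∀ u v → Adj Γ u v ⇔ (u ≢ v × R u v)

≅-from-descriptions : ∀ {Γ Δ R S} → Γ DescribedBy R → Δ DescribedBy S →
                      (f : V Γ ↔ V Δ) → (∀ u v → R u v ⇔ S (to f u) (to f v)) → Γ ≅ᴳ Δ
≅-from-descriptions dΓ dΔ f f-rel = ↔⇒⤖ f , λ u v → ⇔-sym (dΔ _ _) ⇔-∘ ((distinct ×-⇔ f-rel u v) ⇔-∘ dΓ u v)
  where
  distinct : ∀ {u v} → u ≢ v ⇔ to f u ≢ to f v
  distinct = mk⇔ (λ u≢v e → u≢v (↔-injective f e)) (λ fu≢fv e → fu≢fv (cong (to f) e))

Full : {A : Set} → Rel A 0ℓ
Full _ _ = ⊤

_⊎ᴿ_ : {A B : Set} → Rel A 0ℓ → Rel B 0ℓ → Rel (A ⊎ B) 0ℓ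
(R ⊎ᴿ S) (inj₁ a) (inj₁ b) = R a b
(R ⊎ᴿ S) (inj₂ a) (inj₂ b) = S a b
(R ⊎ᴿ S) _        _        = ⊥

_∨ᴿ_ : {A B : Set} → Rel A 0ℓ → Rel B 0ℓ → Rel (A ⊎ B) 0ℓ
(R ∨ᴿ S) (inj₁ a) (inj₁ b) = R a b
(R ∨ᴿ S) (inj₂ a) (inj₂ b) = S a b
(R ∨ᴿ S) _        _        = ⊤

along : ∀ {A B X R : Set} {a b : A} (f : A → B) → (∀ {x y} → f x ≡ f y → x ≡ y) →
        X ⇔ (a ≢ b × R) → X ⇔ (f a ≢ f b × R)
along f f-injective d = mk⇔ (λ x → let (a≢b , r) = ⇒ d x in (λ e → a≢b (f-injective e)) , r)
                            (λ (fa≢fb , r) → ⇐ d ((λ e → fa≢fb (cong f e)) , r))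

K-described : ∀ m → K m DescribedBy Full
K-described m u v = mk⇔ (_, tt) proj₁

∪-described : ∀ {Γ Δ R S} → Γ DescribedBy R → Δ DescribedBy S → (Γ ∪ᴳ Δ) DescribedBy (R ⊎ᴿ S)
∪-described dΓ dΔ (inj₁ a) (inj₁ b) = along inj₁ inj₁-injective (dΓ a b)
∪-described dΓ dΔ (inj₂ a) (inj₂ b) = along inj₂ inj₂-injective (dΔ a b)
∪-described dΓ dΔ (inj₁ a) (inj₂ b) = mk⇔ (λ ()) proj₂
∪-described dΓ dΔ (inj₂ a) (inj₁ b) = mk⇔ (λ ()) proj₂

∨-described : ∀ {Γ Δ R S} → Γ DescribedBy R → Δ DescribedBy S → (Γ ∨ᴳ Δ) DescribedBy (R ∨ᴿ S)
∨-described dΓ dΔ (inj₁ a) (inj₁ b) = along inj₁ inj₁-injective (dΓ a b)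
∨-described dΓ dΔ (inj₂ a) (inj₂ b) = along inj₂ inj₂-injective (dΔ a b)
∨-described dΓ dΔ (inj₁ a) (inj₂ b) = mk⇔ (λ _ → (λ ()) , tt) _
∨-described dΓ dΔ (inj₂ a) (inj₁ b) = mk⇔ (λ _ → (λ ()) , tt) _

inCopy : ∀ {Γ q} → Fin q → V Γ → V (copies q Γ)
inCopy zero    a = inj₁ a
inCopy (suc i) a = inj₂ (inCopy i a)

copy⁻¹ : ∀ {Γ} q → V (copies q Γ) → Fin q × V Γ
copy⁻¹ (suc q) (inj₁ a) = zero , a
copy⁻¹ (suc q) (inj₂ v) = let (i , a) = copy⁻¹ q v in suc i , a

copies-↔ : ∀ {Γ q} → (Fin q × V Γ) ↔ V (copies q Γ)
copies-↔ {Γ} {q} = mk↔ₛ′ (λ (i , a) → inCopy i a) (copy⁻¹ q) (inCopy∘copy⁻¹ q) copy⁻¹∘inCopy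
  where
  inCopy∘copy⁻¹ : ∀ q (v : V (copies q Γ)) → inCopy (proj₁ (copy⁻¹ q v)) (proj₂ (copy⁻¹ q v)) ≡ v
  inCopy∘copy⁻¹ (suc q) (inj₁ a) = refl
  inCopy∘copy⁻¹ (suc q) (inj₂ v) = cong inj₂ (inCopy∘copy⁻¹ q v)
  copy⁻¹∘inCopy : ∀ {q} (x : Fin q × V Γ) → copy⁻¹ q (inCopy (proj₁ x) (proj₂ x)) ≡ x
  copy⁻¹∘inCopy (zero , a)  = refl
  copy⁻¹∘inCopy (suc i , a) = cong (λ (j , b) → suc j , b) (copy⁻¹∘inCopy (i , a))

copiesᴿ : ∀ {Γ} q → Rel (V Γ) 0ℓ → Rel (V (copies q Γ)) 0ℓ
copiesᴿ zero    R () _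
copiesᴿ (suc q) R = R ⊎ᴿ copiesᴿ q R

copies-described : ∀ {Γ R} q → Γ DescribedBy R → copies q Γ DescribedBy copiesᴿ q R
copies-described zero    d ()
copies-described (suc q) d = ∪-described d (copies-described q d)

copiesᴿ-inCopy : ∀ {Γ R q} (i j : Fin q) (a b : V Γ) → copiesᴿ {Γ} q R (inCopy {Γ} i a) (inCopy {Γ} j b) ⇔ (i ≡ j × R a b)
copiesᴿ-inCopy             zero    zero    a b = mk⇔ (refl ,_) proj₂
copiesᴿ-inCopy {Γ} {R} {suc q} (suc i) (suc j) a b =
  (mk⇔ (cong suc) suc-injective ×-⇔ ⇔-refl) ⇔-∘ copiesᴿ-inCopy {Γ} {R} {q} i j a b
copiesᴿ-inCopy             zero    (suc j) a b = mk⇔ (λ ()) (λ ())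
copiesᴿ-inCopy             (suc i) zero    a b = mk⇔ (λ ()) (λ ())

/2^-exact : ∀ q r n → q * 2 ^ r ≡ n → n /2^ r ≡ q
/2^-exact q r n refl = m*n/n≡m q (2 ^ r) {{m^n≢0 2 r}}

module Involutions {n : ℕ} (G : FinAbGroup n) where
  open FinAbGroup G

  abelianGroup : AbelianGroup 0ℓ 0ℓ
  abelianGroup = record { _≈_ = _≡_ ; _∙_ = _∙_ ; ε = e ; _⁻¹ = _⁻¹ ; isAbelianGroup = isAbelianGroup }

  open AbelianGroup abelianGroup using (assoc; comm; identityˡ; inverseʳ; commutativeSemigroup)
  open AbelianGroupProperties abelianGroup
    using (inverseʳ-unique; ⁻¹-anti-homo-//; //-rightDividesˡ; //-rightDividesʳ; \\-leftDividesʳ; ∙-cancelˡ)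
  open CommutativeSemigroupProperties commutativeSemigroup using (interchange)

  Involution : Fin n → Set
  Involution g = g ∙ g ≡ e

  involution? : Decidable Involution
  involution? g = (g ∙ g) ≟ e

  involution⇔self-inverse : ∀ g → Involution g ⇔ g ≡ g ⁻¹
  involution⇔self-inverse g = mk⇔ (inverseʳ-unique g g) (λ g≡g⁻¹ → trans (cong (g ∙_) g≡g⁻¹) (inverseʳ g))

  involution-∙ : ∀ g h → Involution g → Involution h → Involution (g ∙ h)
  involution-∙ g h g²≡e h²≡e = trans (interchange g h g h) (trans (cong₂ _∙_ g²≡e h²≡e) (identityˡ e))

  involution-⁻¹ : ∀ g → Involution g → Involution (g ⁻¹)
  involution-⁻¹ g g²≡e = subst Involution (⇒ (involution⇔self-inverse g) g²≡e) g²≡e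

  _~_ : Rel (Fin n) 0ℓ
  g ~ h = Involution (g ∙ h ⁻¹)

  ~-isEquivalence : IsEquivalence _~_
  ~-isEquivalence = record
    { refl  = λ {g} → subst Involution (sym (inverseʳ g)) (identityˡ e)
    ; sym   = λ {g} {h} g~h → subst Involution (⁻¹-anti-homo-// g h) (involution-⁻¹ _ g~h)
    ; trans = λ {g} {h} {k} g~h h~k → subst Involution (telescope g h k) (involution-∙ _ _ g~h h~k)
    }
    where
    telescope : ∀ g h k → (g ∙ h ⁻¹) ∙ (h ∙ k ⁻¹) ≡ g ∙ k ⁻¹
    telescope g h k = trans (assoc g (h ⁻¹) (h ∙ k ⁻¹)) (cong (g ∙_) (\\-leftDividesʳ h (k ⁻¹)))

  coset↔involutions : ∀ r → Σ (Fin n) (_~ r) ↔ Σ (Fin n) Involution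
  coset↔involutions r = mk↔ₛ′ (λ (y , y~r) → y ∙ r ⁻¹ , y~r)
                              (λ (t , t²≡e) → t ∙ r , subst Involution (sym (//-rightDividesʳ r t)) t²≡e)
                              (λ (t , _) → Σ-≡ Fin-UIP (//-rightDividesʳ r t))
                              (λ (y , _) → Σ-≡ Fin-UIP (//-rightDividesˡ r y))

  private
    same-sign : ∀ {a b : Fin n} {c : C₂} → _≡_ {A = D G} (a , c) (b , c) ⇔ a ≡ b
    same-sign = mk⇔ (cong proj₁) (cong (_, _))

  Commute : Rel (D G) 0ℓ
  Commute u v = _⊗_ G u v ≡ _⊗_ G v u

  rotations-commute : ∀ g h → Commute (g , one) (h , one)
  rotations-commute g h = cong (_, one) (comm g h)

  rotation-reflection-commute : ∀ g h → Commute (g , one) (h , minusOne) ⇔ Involution g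
  rotation-reflection-commute g h = ⇔-sym (involution⇔self-inverse g) ⇔-∘ (cancel ⇔-∘ same-sign)
    where
    cancel : g ∙ h ≡ h ∙ g ⁻¹ ⇔ g ≡ g ⁻¹
    cancel = mk⇔ (λ eq → ∙-cancelˡ h g (g ⁻¹) (trans (comm h g) eq)) (λ eq → trans (comm g h) (cong (h ∙_) eq))

  reflections-commute : ∀ g h → Commute (g , minusOne) (h , minusOne) ⇔ g ~ h
  reflections-commute g h = ⇔-sym (involution⇔self-inverse (g ∙ h ⁻¹)) ⇔-∘ (inverted ⇔-∘ same-sign)
    where
    inverted : g ∙ h ⁻¹ ≡ h ∙ g ⁻¹ ⇔ g ∙ h ⁻¹ ≡ (g ∙ h ⁻¹) ⁻¹
    inverted = mk⇔ (λ eq → trans eq (sym (⁻¹-anti-homo-// g h))) (λ eq → trans eq (⁻¹-anti-homo-// g h))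

module CommutingGraph {n : ℕ} (G : FinAbGroup n) where
  open FinAbGroup G
  open Involutions G

  k : ℕ
  k = numSqrtId G

  rotations : Fin n ↔ (Fin k ⊎ Fin (n ∸ k))
  rotations = partition involution? Fin-UIP

  open Representatives (λ g h → involution? (g ∙ h ⁻¹)) ~-isEquivalence Fin-UIP
    using (#classes; classes; classes-proj₁; #classes*k≡n)

  classSize : ∀ r → Σ (Fin n) (_~ r) ↔ Fin k
  classSize r = Σ-count involution? Fin-UIP id ↔-∘ coset↔involutions r

  reflections : Fin n ↔ V (copies #classes (K k))
  reflections = copies-↔ ↔-∘ classes classSize

  Target : Graph
  Target = K k ∨ᴳ (K (n ∸ k) ∪ᴳ copies #classes (K k))

  TargetRel : Rel (V Target) 0ℓ
  TargetRel = Full ∨ᴿ (Full ⊎ᴿ copiesᴿ #classes Full)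

  target-described : Target DescribedBy TargetRel
  target-described = ∨-described (K-described k) (∪-described (K-described (n ∸ k)) (copies-described #classes (K-described k)))

  bySign : D G ↔ (Fin n ⊎ Fin n)
  bySign = mk↔ₛ′ (λ { (g , one) → inj₁ g ; (g , minusOne) → inj₂ g }) [ (_, one) , (_, minusOne) ]
                 (λ { (inj₁ _) → refl ; (inj₂ _) → refl }) (λ { (_ , one) → refl ; (_ , minusOne) → refl })

  vertices : D G ↔ V Target
  vertices = ⊎-assoc 0ℓ _ _ _ ↔-∘ ((rotations ⊎-↔ reflections) ↔-∘ bySign)

  rotation-images : ∀ x y → TargetRel (assocʳ (inj₁ x)) (assocʳ (inj₁ y))
  rotation-images (inj₁ _) (inj₁ _) = tt
  rotation-images (inj₁ _) (inj₂ _) = tt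
  rotation-images (inj₂ _) (inj₁ _) = tt
  rotation-images (inj₂ _) (inj₂ _) = tt

  rotation-reflection-images : ∀ x w → TargetRel (assocʳ (inj₁ x)) (inj₂ (inj₂ w)) ⇔ IsInj₁ x
  rotation-reflection-images (inj₁ _) w = mk⇔ _ _
  rotation-reflection-images (inj₂ _) w = mk⇔ (λ ()) (λ ())

  reflection-rotation-images : ∀ x w → TargetRel (inj₂ (inj₂ w)) (assocʳ (inj₁ x)) ⇔ IsInj₁ x
  reflection-rotation-images (inj₁ _) w = mk⇔ _ _
  reflection-rotation-images (inj₂ _) w = mk⇔ (λ ()) (λ ())

  reflection-images : ∀ g h → TargetRel (inj₂ (inj₂ (to reflections g))) (inj₂ (inj₂ (to reflections h))) ⇔ g ~ h
  reflection-images g h = classes-proj₁ classSize g h ⇔-∘ (mk⇔ proj₁ (_, tt) ⇔-∘ copiesᴿ-inCopy {K k} {Full} {#classes} _ _ _ _)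

  commute⇔related : ∀ u v → Commute u v ⇔ TargetRel (to vertices u) (to vertices v)
  commute⇔related (g , one) (h , one) = mk⇔ (λ _ → rotation-images (to rotations g) (to rotations h)) (λ _ → rotations-commute g h)
  commute⇔related (g , one) (h , minusOne) =
    ⇔-sym (rotation-reflection-images (to rotations g) _) ⇔-∘
    (⇔-sym (partition-IsInj₁ involution? Fin-UIP g) ⇔-∘ rotation-reflection-commute g h)
  commute⇔related (g , minusOne) (h , one) =
    ⇔-sym (reflection-rotation-images (to rotations h) _) ⇔-∘
    (⇔-sym (partition-IsInj₁ involution? Fin-UIP h) ⇔-∘ (rotation-reflection-commute h g ⇔-∘ mk⇔ sym sym))
  commute⇔related (g , minusOne) (h , minusOne) = ⇔-sym (reflection-images g h) ⇔-∘ reflections-commute g h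

  n/2^r≡#classes : ∀ r → 2 ^ r ≡ k → n /2^ r ≡ #classes
  n/2^r≡#classes r 2^r≡k = /2^-exact #classes r n (trans (cong (#classes *_) 2^r≡k) (#classes*k≡n classSize))

  commutingGraph≅Target : commutingGraph G ≅ᴳ Target
  commutingGraph≅Target = ≅-from-descriptions (λ _ _ → ⇔-refl) target-described vertices commute⇔related

  commutingGraph≅ : ∀ {k′ q} → k′ ≡ k → q ≡ #classes → commutingGraph G ≅ᴳ (K k′ ∨ᴳ (K (n ∸ k′) ∪ᴳ copies q (K k′)))
  commutingGraph≅ refl refl = commutingGraph≅Target

corollary2p2 : (n : ℕ) (G : FinAbGroup n) → ¬ DAbelian G →
    (r : ℕ) → 2 ^ r ≡ numSqrtId G →
    commutingGraph G ≅ᴳ (K (2 ^ r) ∨ᴳ (K (n ∸ 2 ^ r) ∪ᴳ copies (n /2^ r) (K (2 ^ r))))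
corollary2p2 n G _ r 2^r≡k = commutingGraph≅ 2^r≡k (n/2^r≡#classes r 2^r≡k)
  where open CommutingGraph G
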